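{- Let $G=(V,E)$ be a finite simple undirected graph, $F$ an optimal module-preserving cograph edit set for $G$, and $H=(V,E\triangle F)$. Let $M^\star$ be a strong module of $H$ that is not a module of $G$, let $\mathbb{P}_{\max}(H[M^\star])=\{\widetilde M_1,\dots,\widetilde M_k\}$ and $\mathcal C(M^\star)=\{\widehat M_1,\dots,\widehat M_l\}$, and define $$\mathcal X(M^\star)=\{\widetilde M_i: \exists j\ \widehat M_j\subseteq\widetilde M_i\}\cup\{\widehat M_j:\exists i\ \widetilde M_i\subseteq\widehat M_j\}.$$ Then $\mathcal X(M^\star)$ is a partition of $M^\star$. Consequently, for each $M\in\mathcal X(M^\star)$ there are index sets $I\subseteq\{1,\dots,k\}$ and $J\subseteq\{1,\dots,l\}$ with $M=\bigcup_{i\in I}\widetilde M_i=\bigcup_{j\in J}\widehat M_j$.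
   Context: A module of a graph $G$ is a set $M\subseteq V$ with $N(x)\setminus M=N(y)\setminus M$ for all $x,y\in M$. A module $M$ is strong if $M\cap M'\in\{\emptyset,M,M'\}$ for every module $M'$. For a strong module $M$ with $|M|\ge2$ of a graph $X$, $\mathbb{P}_{\max}(X[M])$ is the set of inclusion-maximal strong modules of $X$ properly contained in $M$ (a partition of $M$). A strong module with at least two vertices is prime if it induces a subgraph that is connected and has connected complement. A cograph has no induced path on four vertices. $F\subseteq\binom V2$ is a cograph edit set if $(V,E\triangle F)$ is a cograph; optimal if of minimum cardinality; module-preserving if every module of $G$ is a module of $(V,E\triangle F)$. Under these hypotheses there is an inclusion-minimal prime module $P_{M^\star}$ of $G$ containing $M^\star$, and $\mathcal{C}(M^\star)\subseteq\mathbb{P}_{\max}(G[P_{M^\star}])$ denotes the set of children of $P_{M^\star}$ whose union is $M^\star$. -}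

module Defs where

open import Data.Nat using (ℕ; zero; suc; _+_; _≤_; _<_)
open import Data.Bool using (Bool; true; false; not; _xor_; _∧_; if_then_else_)
open import Data.Bool.Properties using ()
open import Data.Fin using (Fin; toℕ; _≟_)
open import Data.Fin.Subset using (Subset; _∈_; _∉_; _⊆_; _⊂_; Nonempty; Empty; _∩_)
open import Data.Product using (Σ; ∃; ∃-syntax; _×_; _,_)
open import Data.Sum using (_⊎_)
open import Data.List using (List)
open import Data.List.Relation.Unary.All using (All)
open import Data.List.Relation.Unary.Any using (Any)
open import Relation.Nullary using (¬_; Dec; yes; no)
open import Relation.Nullary.Decidable using (⌊_⌋)
open import Relation.Binary.PropositionalEquality using (_≡_; _≢_)
open import Data.Nat using (_<?_)
open import Function.Bundles using (_⇔_)

private variable n : ℕ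

-- Finite simple undirected graphs on vertex set Fin n.
-- A symmetric irreflexive Bool-valued relation.  The same structure is
-- used for edit sets F ⊆ (V choose 2) (a set of unordered pairs).

record Graph (n : ℕ) : Set where
  field
    adj   : Fin n → Fin n → Bool
    sym   : ∀ x y → adj x y ≡ adj y x
    irrefl : ∀ x → adj x x ≡ false
open Graph public

_△_ : Graph n → Graph n → Graph n
adj (G △ F) x y = adj G x y xor adj F x y
sym (G △ F) x y rewrite sym G x y | sym F x y = Relation.Binary.PropositionalEquality.refl
irrefl (G △ F) x rewrite irrefl G x | irrefl F x = Relation.Binary.PropositionalEquality.refl

coadj : Graph n → Fin n → Fin n → Bool
coadj G x y = not (adj G x y) ∧ not ⌊ x ≟ y ⌋

sumFin : ∀ n → (Fin n → ℕ) → ℕ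
sumFin zero    f = 0
sumFin (suc n) f = f Data.Fin.zero + sumFin n (λ i → f (Data.Fin.suc i))

card : Graph n → ℕ
card {n} F = sumFin n (λ x → sumFin n (λ y →
  if ⌊ toℕ x <? toℕ y ⌋ ∧ adj F x y then 1 else 0))

IsCograph : Graph n → Set
IsCograph G = ∀ a b c d →
  ¬ ( adj G a b ≡ true × adj G b c ≡ true × adj G c d ≡ true
    × adj G a c ≡ false × adj G b d ≡ false × adj G a d ≡ false )

IsCographEditSet : Graph n → Graph n → Set
IsCographEditSet G F = IsCograph (G △ F)

IsModule : Graph n → Subset n → Set
IsModule G M = ∀ x y z → x ∈ M → y ∈ M → z ∉ M → adj G x z ≡ adj G y z

Disjoint : Subset n → Subset n → Set
Disjoint M M' = Empty (M ∩ M')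

IsStrongModule : Graph n → Subset n → Set
IsStrongModule G M = IsModule G M ×
  (∀ M' → IsModule G M' → Disjoint M M' ⊎ (M ⊆ M' ⊎ M' ⊆ M))

IsOptimal : Graph n → Graph n → Set
IsOptimal G F = IsCographEditSet G F × (∀ F' → IsCographEditSet G F' → card F ≤ card F')

IsModulePreserving : Graph n → Graph n → Set
IsModulePreserving G F = ∀ M → IsModule G M → IsModule (G △ F) M

IsPmax : Graph n → Subset n → Subset n → Set
IsPmax X M M' = IsStrongModule X M' × M' ⊂ M ×
  (∀ M'' → IsStrongModule X M'' → M'' ⊂ M → M' ⊆ M'' → M'' ⊆ M')

data Reach (R : Fin n → Fin n → Bool) (M : Subset n) : Fin n → Fin n → Set where
  here : ∀ {x} → x ∈ M → Reach R M x x
  step : ∀ {x y z} → Reach R M x y → z ∈ M → R y z ≡ true → Reach R M x z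

ConnectedOn : (Fin n → Fin n → Bool) → Subset n → Set
ConnectedOn R M = ∀ x y → x ∈ M → y ∈ M → Reach R M x y

AtLeastTwo : Subset n → Set
AtLeastTwo M = ∃[ x ] ∃[ y ] (x ∈ M × y ∈ M × x ≢ y)

IsPrime : Graph n → Subset n → Set
IsPrime G M = IsStrongModule G M × AtLeastTwo M
  × ConnectedOn (adj G) M × ConnectedOn (coadj G) M

IsPartitionOf : (Subset n → Set) → Subset n → Set
IsPartitionOf 𝒳 M =
    (∀ A → 𝒳 A → Nonempty A)
  × (∀ A → 𝒳 A → A ⊆ M)
  × (∀ A B → 𝒳 A → 𝒳 B → A ≡ B ⊎ Disjoint A B)
  × (∀ x → x ∈ M → ∃[ A ] (𝒳 A × x ∈ A))

IsUnionOf : Subset n → List (Subset n) → Set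
IsUnionOf A I = ∀ x → (x ∈ A ⇔ Any (x ∈_) I)

{-# OPTIONS --safe #-}

-- Both 𝒫 = P_max(H[M⋆]) and 𝒬 = 𝒞(M⋆) partition M⋆, and two of their blocks
-- that meet are nested: blocks of 𝒫 are strong modules of H, blocks of 𝒬 are
-- modules of G and hence of H.  For two partitions in this position the blocks
-- of either one that contain a block of the other are the maximal blocks of
-- 𝒫 ∪ 𝒬; they partition M⋆ and each is a union of blocks of both.
--
-- The substantial point is that 𝒬 covers M⋆, i.e. that no child of P contains
-- M⋆.  If a child did, take a minimal strong module Q of G with M⋆ ⊆ Q inside
-- it.  Were G[Q] (or its complement) disconnected, its components would be
-- strong modules of G, hence modules of H meeting the strong module M⋆, and
-- minimality of Q forces each component through M⋆ to lie inside M⋆; then no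
-- vertex of Q ∖ M⋆ is adjacent (resp. non-adjacent) to M⋆, so M⋆ would be a
-- module of G.  Hence Q is prime, so Q = P by minimality of P, which is absurd
-- for Q inside a proper child of P.

module Submission where

open import Defs hiding (sym)
open import Data.Nat using (ℕ; zero; suc)
open import Data.Bool using (Bool; true; false; not; _∧_)
open import Data.Bool.Properties using (∧-identityʳ; not-injective; ¬-not)
import Data.Bool.Properties as Bool
open import Data.Fin as Fin using (Fin; _≟_)
open import Data.Fin.Properties using (any?; all?)
open import Data.Fin.Subset
  using (Subset; _∈_; _∉_; _⊆_; _⊂_; _⊃_; Nonempty; _∩_; ⁅_⁆; inside; outside)
open import Data.Fin.Subset.Properties
  using ( _∈?_; _⊆?_; _⊂?_; nonempty?; anySubset?; ⊆-refl; ⊆-reflexive; ⊆-trans; ⊆-antisym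
        ; p⊂q⇒p⊆q; x∈⁅x⁆; x∈⁅y⁆⇒x≡y; x≢y⇒x∉⁅y⁆; x∈p∩q⁺; x∈p∩q⁻)
open import Data.Fin.Subset.Induction using (Acc; acc; ⊂-wellFounded; ⊃-wellFounded)
open import Data.Empty using (⊥-elim)
open import Data.Product using (Σ; ∃-syntax; _×_; _,_; proj₁; proj₂)
open import Data.Sum using (_⊎_; inj₁; inj₂; swap)
import Data.Sum as Sum
open import Data.Vec using ([]; _∷_; tabulate)
open import Data.Vec.Properties using (lookup∘tabulate; lookup⇒[]=; []=⇒lookup)
open import Data.List using (List; [_]; map; _++_; filter)
open import Data.List.Relation.Unary.All using (All)
import Data.List.Relation.Unary.All as All
open import Data.List.Relation.Unary.All.Properties using (all-filter)
open import Data.List.Relation.Unary.Any using (Any; here)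
open import Data.List.Membership.Propositional using (find; lose) renaming (_∈_ to _∈ₗ_)
open import Data.List.Membership.Propositional.Properties
  using (∈-map⁺; ∈-++⁺ˡ; ∈-++⁺ʳ; ∈-filter⁺; ∈-filter⁻)
open import Function using (_∘_)
open import Function.Bundles using (mk⇔)
open import Relation.Nullary using (¬_; Dec; yes; no; does; contradiction)
open import Relation.Nullary.Decidable
  using (_×-dec_; _⊎-dec_; _→-dec_; ¬?; decidable-stable; ¬¬-excluded-middle; dec-true; dec-false; does-⇔; isYes; isYes≗does)
open import Relation.Unary using (Decidable)
open import Relation.Binary.PropositionalEquality
  using (_≡_; _≢_; refl; sym; trans; cong; subst; module ≡-Reasoning)

private variable
  n : ℕ
  x y z : Fin n
  A B M Q S : Subset n

⊈⇒∃∉ : ¬ A ⊆ B → ∃[ x ] (x ∈ A × x ∉ B)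
⊈⇒∃∉ {A = A} {B = B} A⊈B with any? (λ x → x ∈? A ×-dec ¬? (x ∈? B))
... | yes witness = witness
... | no none = contradiction
  (λ {x} x∈A → decidable-stable (x ∈? B) (λ x∉B → none (x , x∈A , x∉B))) A⊈B

⊆∧⊄⇒⊇ : A ⊆ B → ¬ A ⊂ B → B ⊆ A
⊆∧⊄⇒⊇ {A = A} A⊆B A⊄B {x} x∈B =
  decidable-stable (x ∈? A) (λ x∉A → A⊄B (A⊆B , x , x∈B , x∉A))

∀-Subset? : {𝒫 : Subset n → Set} → Decidable 𝒫 → Dec (∀ S → 𝒫 S)
∀-Subset? 𝒫? with anySubset? (¬? ∘ 𝒫?)
... | yes (S , ¬𝒫S) = no (λ all → ¬𝒫S (all S))
... | no none = yes (λ S → decidable-stable (𝒫? S) (λ ¬𝒫S → none (S , ¬𝒫S)))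

AtLeastTwo-⊆ : A ⊆ B → AtLeastTwo A → AtLeastTwo B
AtLeastTwo-⊆ A⊆B (x , y , x∈A , y∈A , x≢y) = x , y , A⊆B x∈A , A⊆B y∈A , x≢y

⁅⁆⊂ : AtLeastTwo M → x ∈ M → ⁅ x ⁆ ⊂ M
⁅⁆⊂ {M = M} {x = x} (a , b , a∈M , b∈M , a≢b) x∈M = ⁅x⁆⊆M , outside-⁅x⁆ (x ≟ a)
  where
  ⁅x⁆⊆M : ⁅ x ⁆ ⊆ M
  ⁅x⁆⊆M y∈⁅x⁆ = subst (_∈ M) (sym (x∈⁅y⁆⇒x≡y x y∈⁅x⁆)) x∈M
  outside-⁅x⁆ : Dec (x ≡ a) → ∃[ y ] (y ∈ M × y ∉ ⁅ x ⁆)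
  outside-⁅x⁆ (yes refl) = b , b∈M , x≢y⇒x∉⁅y⁆ (a≢b ∘ sym)
  outside-⁅x⁆ (no x≢a)   = a , a∈M , x≢y⇒x∉⁅y⁆ (x≢a ∘ sym)

subsets : ∀ n → List (Subset n)
subsets zero    = [ [] ]
subsets (suc n) = map (inside ∷_) (subsets n) ++ map (outside ∷_) (subsets n)

∈-subsets : (S : Subset n) → S ∈ₗ subsets n
∈-subsets []                      = here refl
∈-subsets (inside ∷ S)            = ∈-++⁺ˡ (∈-map⁺ (inside ∷_) (∈-subsets S))
∈-subsets {suc n} (outside ∷ S) = ∈-++⁺ʳ (map (inside ∷_) (subsets n)) (∈-map⁺ (outside ∷_) (∈-subsets S))

module _ {P : Fin n → Set} (P? : Decidable P) where

  fromDec : Subset n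
  fromDec = tabulate (does ∘ P?)

  ∈-fromDec⁺ : P x → x ∈ fromDec
  ∈-fromDec⁺ {x = x} Px =
    lookup⇒[]= x fromDec (trans (lookup∘tabulate (does ∘ P?) x) (dec-true (P? x) Px))

  ∈-fromDec⁻ : x ∈ fromDec → P x
  ∈-fromDec⁻ {x = x} x∈ with P? x | trans (sym (lookup∘tabulate (does ∘ P?) x)) ([]=⇒lookup x∈)
  ... | yes Px | _ = Px
  ... | no _   | ()

module _ {𝒫 : Subset n → Set} (𝒫? : Decidable 𝒫) where

  maximal-⊇ : 𝒫 S → ∃[ T ] (𝒫 T × S ⊆ T × (∀ {U} → 𝒫 U → T ⊆ U → U ⊆ T))
  maximal-⊇ {S = S} = go (⊃-wellFounded S)
    where
    go : ∀ {S} → Acc _⊃_ S → 𝒫 S → ∃[ T ] (𝒫 T × S ⊆ T × (∀ {U} → 𝒫 U → T ⊆ U → U ⊆ T))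
    go {S} (acc larger) 𝒫S with anySubset? (λ U → 𝒫? U ×-dec S ⊂? U)
    ... | yes (U , 𝒫U , S⊂U) =
      let (T , 𝒫T , U⊆T , T-maximal) = go (larger S⊂U) 𝒫U
      in T , 𝒫T , ⊆-trans (p⊂q⇒p⊆q S⊂U) U⊆T , T-maximal
    ... | no none = S , 𝒫S , ⊆-refl , λ 𝒫U S⊆U → ⊆∧⊄⇒⊇ S⊆U (λ S⊂U → none (_ , 𝒫U , S⊂U))

  minimal-⊆ : 𝒫 S → ∃[ T ] (𝒫 T × T ⊆ S × (∀ {U} → 𝒫 U → U ⊆ T → T ⊆ U))
  minimal-⊆ {S = S} = go (⊂-wellFounded S)
    where
    go : ∀ {S} → Acc _⊂_ S → 𝒫 S → ∃[ T ] (𝒫 T × T ⊆ S × (∀ {U} → 𝒫 U → U ⊆ T → T ⊆ U))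
    go {S} (acc smaller) 𝒫S with anySubset? (λ U → 𝒫? U ×-dec U ⊂? S)
    ... | yes (U , 𝒫U , U⊂S) =
      let (T , 𝒫T , T⊆U , T-minimal) = go (smaller U⊂S) 𝒫U
      in T , 𝒫T , ⊆-trans T⊆U (p⊂q⇒p⊆q U⊂S) , T-minimal
    ... | no none = S , 𝒫S , ⊆-refl , λ 𝒫U U⊆S → ⊆∧⊄⇒⊇ U⊆S (λ U⊂S → none (_ , 𝒫U , U⊂S))

module Partition {𝒫 : Subset n → Set} {M : Subset n} (partition : IsPartitionOf 𝒫 M) where

  block-nonempty : 𝒫 A → Nonempty A
  block-nonempty = proj₁ partition _

  block-⊆ : 𝒫 A → A ⊆ M
  block-⊆ = proj₁ (proj₂ partition) _

  block-unique : 𝒫 A → 𝒫 B → x ∈ A → x ∈ B → A ≡ B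
  block-unique 𝒫A 𝒫B x∈A x∈B with proj₁ (proj₂ (proj₂ partition)) _ _ 𝒫A 𝒫B
  ... | inj₁ A≡B      = A≡B
  ... | inj₂ disjoint = contradiction (_ , x∈p∩q⁺ (x∈A , x∈B)) disjoint

  block-⊆-block : 𝒫 A → 𝒫 B → A ⊆ B → A ≡ B
  block-⊆-block 𝒫A 𝒫B A⊆B = let (x , x∈A) = block-nonempty 𝒫A in block-unique 𝒫A 𝒫B x∈A (A⊆B x∈A)

  blockOf : x ∈ M → ∃[ A ] (𝒫 A × x ∈ A)
  blockOf = proj₂ (proj₂ (proj₂ partition)) _

mkPartition : {𝒫 : Subset n → Set} →
  (∀ {A} → 𝒫 A → Nonempty A) → (∀ {A} → 𝒫 A → A ⊆ M) →
  (∀ {A B x} → 𝒫 A → 𝒫 B → x ∈ A → x ∈ B → A ≡ B) →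
  (∀ {x} → x ∈ M → ∃[ A ] (𝒫 A × x ∈ A)) →
  IsPartitionOf 𝒫 M
mkPartition {𝒫 = 𝒫} nonempty ⊆M unique cover =
  (λ _ → nonempty) , (λ _ → ⊆M) , equal-or-disjoint , (λ _ → cover)
  where
  equal-or-disjoint : ∀ A B → 𝒫 A → 𝒫 B → A ≡ B ⊎ Disjoint A B
  equal-or-disjoint A B 𝒫A 𝒫B with nonempty? (A ∩ B)
  ... | yes (x , x∈A∩B) = let (x∈A , x∈B) = x∈p∩q⁻ A B x∈A∩B in inj₁ (unique 𝒫A 𝒫B x∈A x∈B)
  ... | no disjoint     = inj₂ disjoint

restrict-isPartition : {𝒫 : Subset n → Set} → IsPartitionOf 𝒫 S →
  (∀ {x} → x ∈ M → ∃[ A ] ((𝒫 A × A ⊆ M) × x ∈ A)) →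
  IsPartitionOf (λ A → 𝒫 A × A ⊆ M) M
restrict-isPartition partition cover =
  mkPartition (block-nonempty ∘ proj₁) proj₂ (λ (𝒫A , _) (𝒫B , _) → block-unique 𝒫A 𝒫B) cover
  where open Partition partition

-- Join is the join of 𝒫 and 𝒬 in the lattice of partitions; it is the paper's
-- 𝒳(M⋆) for 𝒫 = P_max(H[M⋆]) and 𝒬 = 𝒞(M⋆).
module Laminar {𝒫 𝒬 : Subset n → Set} {M : Subset n}
  (𝒫-partition : IsPartitionOf 𝒫 M) (𝒬-partition : IsPartitionOf 𝒬 M)
  (nested : ∀ {A B x} → 𝒫 A → 𝒬 B → x ∈ A → x ∈ B → A ⊆ B ⊎ B ⊆ A) where

  private
    module 𝒫 = Partition 𝒫-partition
    module 𝒬 = Partition 𝒬-partition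

  Block : Subset n → Set
  Block A = 𝒫 A ⊎ 𝒬 A

  Join : Subset n → Set
  Join A = (𝒫 A × ∃[ B ] (𝒬 B × B ⊆ A)) ⊎ (𝒬 A × ∃[ B ] (𝒫 B × B ⊆ A))

  block-nested : Block A → Block B → x ∈ A → x ∈ B → A ⊆ B ⊎ B ⊆ A
  block-nested (inj₁ 𝒫A) (inj₁ 𝒫B) x∈A x∈B = inj₁ (⊆-reflexive (𝒫.block-unique 𝒫A 𝒫B x∈A x∈B))
  block-nested (inj₂ 𝒬A) (inj₂ 𝒬B) x∈A x∈B = inj₁ (⊆-reflexive (𝒬.block-unique 𝒬A 𝒬B x∈A x∈B))
  block-nested (inj₁ 𝒫A) (inj₂ 𝒬B) x∈A x∈B = nested 𝒫A 𝒬B x∈A x∈B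
  block-nested (inj₂ 𝒬A) (inj₁ 𝒫B) x∈A x∈B = swap (nested 𝒫B 𝒬A x∈B x∈A)

  join-block : Join A → Block A
  join-block = Sum.map proj₁ proj₁

  join-maximal : Join A → Block B → A ⊆ B → B ⊆ A
  join-maximal (inj₁ (𝒫A , _)) (inj₁ 𝒫B) A⊆B = ⊆-reflexive (sym (𝒫.block-⊆-block 𝒫A 𝒫B A⊆B))
  join-maximal (inj₂ (𝒬A , _)) (inj₂ 𝒬B) A⊆B = ⊆-reflexive (sym (𝒬.block-⊆-block 𝒬A 𝒬B A⊆B))
  join-maximal {A = A} (inj₁ (_ , C , 𝒬C , C⊆A)) (inj₂ 𝒬B) A⊆B =
    subst (_⊆ A) (𝒬.block-⊆-block 𝒬C 𝒬B (⊆-trans C⊆A A⊆B)) C⊆A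
  join-maximal {A = A} (inj₂ (_ , C , 𝒫C , C⊆A)) (inj₁ 𝒫B) A⊆B =
    subst (_⊆ A) (𝒫.block-⊆-block 𝒫C 𝒫B (⊆-trans C⊆A A⊆B)) C⊆A

  join-⊆ : Join A → A ⊆ M
  join-⊆ = Sum.[ 𝒫.block-⊆ ∘ proj₁ , 𝒬.block-⊆ ∘ proj₁ ]

  join-unique : Join A → Join B → x ∈ A → x ∈ B → A ≡ B
  join-unique JA JB x∈A x∈B with block-nested (join-block JA) (join-block JB) x∈A x∈B
  ... | inj₁ A⊆B = ⊆-antisym A⊆B (join-maximal JA (join-block JB) A⊆B)
  ... | inj₂ B⊆A = ⊆-antisym (join-maximal JB (join-block JA) B⊆A) B⊆A

  join-cover : x ∈ M → ∃[ A ] (Join A × x ∈ A)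
  join-cover x∈M with 𝒫.blockOf x∈M | 𝒬.blockOf x∈M
  ... | A , 𝒫A , x∈A | B , 𝒬B , x∈B with nested 𝒫A 𝒬B x∈A x∈B
  ...   | inj₁ A⊆B = B , inj₂ (𝒬B , A , 𝒫A , A⊆B) , x∈B
  ...   | inj₂ B⊆A = A , inj₁ (𝒫A , B , 𝒬B , B⊆A) , x∈A

  join-isPartition : IsPartitionOf Join M
  join-isPartition =
    mkPartition (Sum.[ 𝒫.block-nonempty , 𝒬.block-nonempty ] ∘ join-block) join-⊆ join-unique join-cover

  join-refines : {ℛ : Subset n → Set} → (∀ {T} → ℛ T → Block T) → IsPartitionOf ℛ M →
    Join A → x ∈ A → ∃[ T ] ((ℛ T × T ⊆ A) × x ∈ T)
  join-refines ℛ⇒Block ℛ-partition JA x∈A with Partition.blockOf ℛ-partition (join-⊆ JA x∈A)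
  ... | T , ℛT , x∈T with block-nested (ℛ⇒Block ℛT) (join-block JA) x∈T x∈A
  ...   | inj₁ T⊆A = T , (ℛT , T⊆A) , x∈T
  ...   | inj₂ A⊆T = T , (ℛT , join-maximal JA (ℛ⇒Block ℛT) A⊆T) , x∈T

union-of-blocks : {ℛ : Subset n → Set} → Decidable ℛ → (A : Subset n) →
  (∀ {x} → x ∈ A → ∃[ T ] ((ℛ T × T ⊆ A) × x ∈ T)) →
  Σ (List (Subset n)) λ I → All ℛ I × IsUnionOf A I
union-of-blocks {n = n} {ℛ = ℛ} ℛ? A cover =
  filter block⊆A? (subsets n) , All.map proj₁ (all-filter block⊆A? (subsets n)) , λ x → mk⇔ to from
  where
  block⊆A? : Decidable (λ T → ℛ T × T ⊆ A)
  block⊆A? T = ℛ? T ×-dec T ⊆? A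
  to : x ∈ A → Any (x ∈_) (filter block⊆A? (subsets n))
  to x∈A = let (T , ℛT⊆A , x∈T) = cover x∈A in lose (∈-filter⁺ block⊆A? (∈-subsets T) ℛT⊆A) x∈T
  from : Any (x ∈_) (filter block⊆A? (subsets n)) → x ∈ A
  from x∈⋃ = let (T , T∈ , x∈T) = find x∈⋃ in proj₂ (proj₂ (∈-filter⁻ block⊆A? {xs = subsets n} T∈)) x∈T

module _ (X : Graph n) where

  isModule? : Decidable (IsModule X)
  isModule? M = all? λ x → all? λ y → all? λ z →
    x ∈? M →-dec y ∈? M →-dec ¬? (z ∈? M) →-dec adj X x z Bool.≟ adj X y z

  isStrongModule? : Decidable (IsStrongModule X)
  isStrongModule? M = isModule? M ×-dec ∀-Subset? λ M' →
    isModule? M' →-dec (¬? (nonempty? (M ∩ M')) ⊎-dec M ⊆? M' ⊎-dec M' ⊆? M)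

  isPmax? : (M : Subset n) → Decidable (IsPmax X M)
  isPmax? M A = isStrongModule? A ×-dec A ⊂? M ×-dec ∀-Subset? λ M'' →
    isStrongModule? M'' →-dec M'' ⊂? M →-dec A ⊆? M'' →-dec M'' ⊆? A

  ¬IsModule⇒AtLeastTwo : ¬ IsModule X M → AtLeastTwo M
  ¬IsModule⇒AtLeastTwo {M = M} not-module
    with any? (λ a → any? λ b → a ∈? M ×-dec b ∈? M ×-dec ¬? (a ≟ b))
  ... | yes (a , b , two) = a , b , two
  ... | no none = contradiction
    (λ x y z x∈M y∈M _ → cong (λ w → adj X w z)
      (decidable-stable (x ≟ y) (λ x≢y → none (x , y , x∈M , y∈M , x≢y))))
    not-module

  ⁅⁆-isStrongModule : ∀ x → IsStrongModule X ⁅ x ⁆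
  ⁅⁆-isStrongModule x = ⁅x⁆-module , λ M' _ → nested M' (x ∈? M')
    where
    ⁅x⁆-module : IsModule X ⁅ x ⁆
    ⁅x⁆-module a b z a∈ b∈ _ =
      cong (λ w → adj X w z) (trans (x∈⁅y⁆⇒x≡y x a∈) (sym (x∈⁅y⁆⇒x≡y x b∈)))
    nested : ∀ M' → Dec (x ∈ M') → Disjoint ⁅ x ⁆ M' ⊎ (⁅ x ⁆ ⊆ M' ⊎ M' ⊆ ⁅ x ⁆)
    nested M' (yes x∈M') = inj₂ (inj₁ λ y∈⁅x⁆ → subst (_∈ M') (sym (x∈⁅y⁆⇒x≡y x y∈⁅x⁆)) x∈M')
    nested M' (no x∉M')  = inj₁ λ (y , y∈⁅x⁆∩M') →
      let (y∈⁅x⁆ , y∈M') = x∈p∩q⁻ ⁅ x ⁆ M' y∈⁅x⁆∩M' in x∉M' (subst (_∈ M') (x∈⁅y⁆⇒x≡y x y∈⁅x⁆) y∈M')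

  strong-nested : IsStrongModule X A → IsModule X B → x ∈ A → x ∈ B → A ⊆ B ⊎ B ⊆ A
  strong-nested (_ , strong) B-module x∈A x∈B with strong _ B-module
  ... | inj₁ disjoint = contradiction (_ , x∈p∩q⁺ (x∈A , x∈B)) disjoint
  ... | inj₂ nested   = nested

  IsPmax-unique : IsPmax X M A → IsPmax X M B → x ∈ A → x ∈ B → A ≡ B
  IsPmax-unique (A-strong , A⊂M , A-maximal) (B-strong , B⊂M , B-maximal) x∈A x∈B
    with strong-nested A-strong (proj₁ B-strong) x∈A x∈B
  ... | inj₁ A⊆B = ⊆-antisym A⊆B (A-maximal _ B-strong B⊂M A⊆B)
  ... | inj₂ B⊆A = ⊆-antisym (B-maximal _ A-strong A⊂M B⊆A) B⊆A

  IsPmax-nonempty : AtLeastTwo M → IsPmax X M A → Nonempty A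
  IsPmax-nonempty {A = A} two@(a , _ , a∈M , _) (_ , _ , A-maximal) =
    decidable-stable (nonempty? A) λ A-empty →
      A-empty (a , A-maximal ⁅ a ⁆ (⁅⁆-isStrongModule a) (⁅⁆⊂ two a∈M)
                     (λ x∈A → contradiction (_ , x∈A) A-empty) (x∈⁅x⁆ a))

  Pmax-isPartition : AtLeastTwo M → IsPartitionOf (IsPmax X M) M
  Pmax-isPartition {M = M} two =
    mkPartition (IsPmax-nonempty two) (λ (_ , A⊂M , _) → proj₁ A⊂M) IsPmax-unique cover
    where
    cover : x ∈ M → ∃[ A ] (IsPmax X M A × x ∈ A)
    cover {x = x} x∈M
      with maximal-⊇ (λ S → isStrongModule? S ×-dec S ⊂? M) (⁅⁆-isStrongModule x , ⁅⁆⊂ two x∈M)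
    ... | A , (A-strong , A⊂M) , ⁅x⁆⊆A , A-maximal =
      A , (A-strong , A⊂M , λ M'' M''-strong M''⊂M → A-maximal (M''-strong , M''⊂M)) , ⁅x⁆⊆A (x∈⁅x⁆ x)

module _ {R : Fin n → Fin n → Bool} {Q : Subset n} where

  Reach-target : Reach R Q x y → y ∈ Q
  Reach-target (here y∈Q)     = y∈Q
  Reach-target (step _ y∈Q _) = y∈Q

  Reach-trans : Reach R Q x y → Reach R Q y z → Reach R Q x z
  Reach-trans x↝y (here _)           = x↝y
  Reach-trans x↝y (step y↝z w∈Q Rzw) = step (Reach-trans x↝y y↝z) w∈Q Rzw

  Reach-sym : (∀ a b → R a b ≡ R b a) → Reach R Q x y → Reach R Q y x
  Reach-sym R-sym (here x∈Q)         = here x∈Q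
  Reach-sym R-sym (step x↝w y∈Q Rwy) =
    Reach-trans (step (here y∈Q) (Reach-target x↝w) (trans (R-sym _ _) Rwy)) (Reach-sym R-sym x↝w)

  Reach-exit : Reach R Q x y → x ∈ S → y ∉ S →
    ∃[ b ] ∃[ c ] (Reach R Q x b × b ∈ S × c ∈ Q × c ∉ S × R b c ≡ true)
  Reach-exit (here _) x∈S y∉S = contradiction x∈S y∉S
  Reach-exit {S = S} (step {y = w} x↝w y∈Q Rwy) x∈S y∉S with w ∈? S
  ... | yes w∈S = w , _ , x↝w , w∈S , y∈Q , y∉S , Rwy
  ... | no w∉S  = Reach-exit x↝w x∈S w∉S

-- sign is id or not: off the diagonal R is the adjacency of G or of its complement.
record AdjOrCoadj (G : Graph n) (R : Fin n → Fin n → Bool) : Set where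
  field
    R-sym          : ∀ a b → R a b ≡ R b a
    sign           : Bool → Bool
    sign-injective : ∀ {b c} → sign b ≡ sign c → b ≡ c
    R≡sign∘adj     : ∀ {a b} → a ≢ b → R a b ≡ sign (adj G a b)

adj-AdjOrCoadj : (G : Graph n) → AdjOrCoadj G (adj G)
adj-AdjOrCoadj G = record
  { R-sym = Graph.sym G ; sign = λ b → b ; sign-injective = λ b≡c → b≡c ; R≡sign∘adj = λ _ → refl }

coadj-AdjOrCoadj : (G : Graph n) → AdjOrCoadj G (coadj G)
coadj-AdjOrCoadj G = record
  { R-sym = λ a b → cong₂-∧ (cong not (Graph.sym G a b)) (cong not (≟-sym a b))
  ; sign = not
  ; sign-injective = not-injective
  ; R≡sign∘adj = λ {a} {b} a≢b →
      trans (cong (λ d → not (adj G a b) ∧ not d) (trans (isYes≗does (a ≟ b)) (dec-false (a ≟ b) a≢b)))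
            (∧-identityʳ _)
  }
  where
  ≟-sym : ∀ a b → isYes (a ≟ b) ≡ isYes (b ≟ a)
  ≟-sym a b = begin
    isYes (a ≟ b) ≡⟨ isYes≗does (a ≟ b) ⟩
    does (a ≟ b)  ≡⟨ does-⇔ (mk⇔ sym sym) (a ≟ b) (b ≟ a) ⟩
    does (b ≟ a)  ≡⟨ isYes≗does (b ≟ a) ⟨
    isYes (b ≟ a) ∎
    where open ≡-Reasoning
  cong₂-∧ : ∀ {p q r s} → p ≡ q → r ≡ s → p ∧ r ≡ q ∧ s
  cong₂-∧ refl refl = refl

module Components {G : Graph n} {R : Fin n → Fin n → Bool} (view : AdjOrCoadj G R) where
  open AdjOrCoadj view

  module-R-uniform : IsModule G M → x ∈ M → y ∈ M → z ∉ M → R x z ≡ R y z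
  module-R-uniform {M = M} {z = z} M-module x∈M y∈M z∉M = begin
    R _ z            ≡⟨ R≡sign∘adj (outside-≢ x∈M) ⟩
    sign (adj G _ z) ≡⟨ cong sign (M-module _ _ z x∈M y∈M z∉M) ⟩
    sign (adj G _ z) ≡⟨ R≡sign∘adj (outside-≢ y∈M) ⟨
    R _ z            ∎
    where
    open ≡-Reasoning
    outside-≢ : ∀ {w} → w ∈ M → w ≢ z
    outside-≢ w∈M refl = z∉M w∈M

  R-closed⇒isModule : IsModule G Q → S ⊆ Q →
    (∀ {w z} → w ∈ S → z ∈ Q → z ∉ S → R w z ≡ false) → IsModule G S
  R-closed⇒isModule {Q = Q} {S = S} Q-module S⊆Q closed x y z x∈S y∈S z∉S with z ∈? Q
  ... | no z∉Q  = Q-module x y z (S⊆Q x∈S) (S⊆Q y∈S) z∉Q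
  ... | yes z∈Q = sign-injective (begin
    sign (adj G x z) ≡⟨ R≡sign∘adj (outside-≢ x∈S) ⟨
    R x z            ≡⟨ closed x∈S z∈Q z∉S ⟩
    false            ≡⟨ closed y∈S z∈Q z∉S ⟨
    R y z            ≡⟨ R≡sign∘adj (outside-≢ y∈S) ⟩
    sign (adj G y z) ∎)
    where
    open ≡-Reasoning
    outside-≢ : ∀ {w} → w ∈ S → w ≢ z
    outside-≢ w∈S refl = z∉S w∈S

  module Component {Q : Subset n} (reach? : ∀ a b → Dec (Reach R Q a b)) (a : Fin n) where

    component : Subset n
    component = fromDec (reach? a)

    ∈-component⁺ : Reach R Q a x → x ∈ component
    ∈-component⁺ = ∈-fromDec⁺ (reach? a)

    ∈-component⁻ : x ∈ component → Reach R Q a x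
    ∈-component⁻ = ∈-fromDec⁻ (reach? a)

    component-⊆ : component ⊆ Q
    component-⊆ = Reach-target ∘ ∈-component⁻

    ⊆-component⇒connected : Q ⊆ component → ConnectedOn R Q
    ⊆-component⇒connected Q⊆K x y x∈Q y∈Q =
      Reach-trans (Reach-sym R-sym (∈-component⁻ (Q⊆K x∈Q))) (∈-component⁻ (Q⊆K y∈Q))

    component-R-closed : x ∈ component → z ∈ Q → z ∉ component → R x z ≡ false
    component-R-closed x∈K z∈Q z∉K =
      ¬-not (λ Rxz → z∉K (∈-component⁺ (step (∈-component⁻ x∈K) z∈Q Rxz)))

    -- The walk from x to y leaves M through an edge b c; every vertex of M is
    -- joined to c just as b is, so it is reached as well.
    module-meeting-component : IsStrongModule G Q → IsModule G M →
      x ∈ component → x ∈ M → y ∈ component → y ∉ M → M ⊆ component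
    module-meeting-component Q-strong M-module x∈K x∈M y∈K y∉M {w} w∈M
      with strong-nested G Q-strong M-module (component-⊆ x∈K) x∈M
    ... | inj₁ Q⊆M = contradiction (Q⊆M (component-⊆ y∈K)) y∉M
    ... | inj₂ M⊆Q
      with Reach-exit (Reach-trans (Reach-sym R-sym (∈-component⁻ x∈K)) (∈-component⁻ y∈K)) x∈M y∉M
    ...   | b , c , x↝b , b∈M , c∈Q , c∉M , Rbc =
      ∈-component⁺ (step a↝c (M⊆Q w∈M) (begin
        R c w ≡⟨ R-sym c w ⟩
        R w c ≡⟨ module-R-uniform M-module w∈M b∈M c∉M ⟩
        R b c ≡⟨ Rbc ⟩
        true  ∎))
      where
      open ≡-Reasoning
      a↝c : Reach R Q a c
      a↝c = step (Reach-trans (∈-component⁻ x∈K) x↝b) c∈Q Rbc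

    component-isStrongModule : IsStrongModule G Q → IsStrongModule G component
    component-isStrongModule Q-strong =
      R-closed⇒isModule (proj₁ Q-strong) component-⊆ component-R-closed , nested
      where
      nested : ∀ M → IsModule G M → Disjoint component M ⊎ (component ⊆ M ⊎ M ⊆ component)
      nested M M-module with nonempty? (component ∩ M) | component ⊆? M
      ... | no disjoint     | _        = inj₁ disjoint
      ... | yes _           | yes K⊆M = inj₂ (inj₁ K⊆M)
      ... | yes (x , x∈K∩M) | no K⊈M  =
        let (x∈K , x∈M) = x∈p∩q⁻ component M x∈K∩M
            (y , y∈K , y∉M) = ⊈⇒∃∉ K⊈M
        in inj₂ (inj₂ (module-meeting-component Q-strong M-module x∈K x∈M y∈K y∉M))

¬¬-∀-Fin : ∀ n {P : Fin n → Set} → (∀ i → ¬ ¬ P i) → ¬ ¬ (∀ i → P i)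
¬¬-∀-Fin zero    _   ¬all = ¬all (λ ())
¬¬-∀-Fin (suc n) ¬¬P ¬all = ¬¬P Fin.zero λ P0 → ¬¬-∀-Fin n (¬¬P ∘ Fin.suc) λ Psuc →
  ¬all λ { Fin.zero → P0 ; (Fin.suc i) → Psuc i }

¬¬-decidable₂ : (P : Fin n → Fin n → Set) → ¬ ¬ (∀ a b → Dec (P a b))
¬¬-decidable₂ {n = n} P = ¬¬-∀-Fin n λ a → ¬¬-∀-Fin n λ b → ¬¬-excluded-middle

module MinimalAbove {G H : Graph n} (preserves : ∀ M → IsModule G M → IsModule H M)
  {M⋆ : Subset n} (M⋆-strong : IsStrongModule H M⋆) (M⋆-not-module : ¬ IsModule G M⋆)
  {Q : Subset n} (Q-strong : IsStrongModule G Q) (M⋆⊆Q : M⋆ ⊆ Q)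
  (Q-minimal : ∀ {T} → IsStrongModule G T × M⋆ ⊆ T → T ⊆ Q → Q ⊆ T) where

  module Disconnected {R : Fin n → Fin n → Bool} (view : AdjOrCoadj G R)
    (disconnected : ¬ ConnectedOn R Q) (reach? : ∀ a b → Dec (Reach R Q a b)) where
    open Components view
    open Component reach?

    K-strong : ∀ x → IsStrongModule G (component x)
    K-strong x = component-isStrongModule x Q-strong

    component-⊆-M⋆ : x ∈ M⋆ → component x ⊆ M⋆
    component-⊆-M⋆ {x = x} x∈M⋆
      with strong-nested H M⋆-strong (preserves _ (proj₁ (K-strong x))) x∈M⋆
             (∈-component⁺ x (here (M⋆⊆Q x∈M⋆)))
    ... | inj₁ M⋆⊆K = contradiction
      (⊆-component⇒connected x (Q-minimal (K-strong x , M⋆⊆K) (component-⊆ x)))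
      disconnected
    ... | inj₂ K⊆M⋆ = K⊆M⋆

    M⋆-isModule : IsModule G M⋆
    M⋆-isModule = R-closed⇒isModule (proj₁ Q-strong) M⋆⊆Q λ {w} w∈M⋆ z∈Q z∉M⋆ →
      ¬-not λ Rwz → z∉M⋆ (component-⊆-M⋆ w∈M⋆ (∈-component⁺ w (step (here (M⋆⊆Q w∈M⋆)) z∈Q Rwz)))

  -- Components need decidable reachability, which we may assume since the goal is ⊥.
  minimal-connected : {R : Fin n → Fin n → Bool} → AdjOrCoadj G R → ¬ ¬ ConnectedOn R Q
  minimal-connected {R = R} view disconnected = ¬¬-decidable₂ (Reach R Q) λ reach? →
    M⋆-not-module (Disconnected.M⋆-isModule view disconnected reach?)

  minimal-isPrime : ¬ ¬ IsPrime G Q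
  minimal-isPrime not-prime =
    minimal-connected (adj-AdjOrCoadj G) λ connected →
    minimal-connected (coadj-AdjOrCoadj G) λ coconnected →
    not-prime (Q-strong , AtLeastTwo-⊆ M⋆⊆Q (¬IsModule⇒AtLeastTwo G M⋆-not-module) , connected , coconnected)

module Children {G H : Graph n} (preserves : ∀ M → IsModule G M → IsModule H M)
  {M⋆ : Subset n} (M⋆-strong : IsStrongModule H M⋆) (M⋆-not-module : ¬ IsModule G M⋆)
  {P : Subset n} (P-prime : IsPrime G P) (M⋆⊆P : M⋆ ⊆ P)
  (P-minimal : ∀ P' → IsPrime G P' → M⋆ ⊆ P' → P' ⊆ P → P' ≡ P) where

  child-⊉-M⋆ : IsPmax G P A → ¬ M⋆ ⊆ A
  child-⊉-M⋆ (A-strong , (A⊆P , y , y∈P , y∉A) , _) M⋆⊆A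
    with minimal-⊆ (λ T → isStrongModule? G T ×-dec M⋆ ⊆? T) (A-strong , M⋆⊆A)
  ... | Q , (Q-strong , M⋆⊆Q) , Q⊆A , Q-minimal =
    MinimalAbove.minimal-isPrime {G = G} {H = H} preserves M⋆-strong M⋆-not-module
      Q-strong M⋆⊆Q Q-minimal λ Q-prime →
      y∉A (Q⊆A (subst (y ∈_) (sym (P-minimal Q Q-prime M⋆⊆Q (⊆-trans Q⊆A A⊆P))) y∈P))

  children-isPartition : IsPartitionOf (λ A → IsPmax G P A × A ⊆ M⋆) M⋆
  children-isPartition = restrict-isPartition P-children child-inside
    where
    P-children : IsPartitionOf (IsPmax G P) P
    P-children = Pmax-isPartition G (proj₁ (proj₂ P-prime))
    child-inside : x ∈ M⋆ → ∃[ A ] ((IsPmax G P A × A ⊆ M⋆) × x ∈ A)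
    child-inside x∈M⋆ with Partition.blockOf P-children (M⋆⊆P x∈M⋆)
    ... | A , A-child , x∈A with strong-nested H M⋆-strong (preserves A (proj₁ (proj₁ A-child))) x∈M⋆ x∈A
    ...   | inj₁ M⋆⊆A = ⊥-elim (child-⊉-M⋆ A-child M⋆⊆A)
    ...   | inj₂ A⊆M⋆ = A , (A-child , A⊆M⋆) , x∈A

proposition2 : (n : ℕ) (G F : Graph n)
    → IsOptimal G F
    → IsModulePreserving G F
    → (M⋆ : Subset n)
    → IsStrongModule (G △ F) M⋆
    → ¬ IsModule G M⋆
    → (P : Subset n)
    → IsPrime G P
    → M⋆ ⊆ P
    → (∀ P' → IsPrime G P' → M⋆ ⊆ P' → P' ⊆ P → P' ≡ P)
    → let H = G △ F
          Pt = λ A → IsPmax H M⋆ A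
          C = λ A → IsPmax G P A × A ⊆ M⋆
          X = λ A → (Pt A × ∃[ B ] (C B × B ⊆ A)) ⊎ (C A × ∃[ B ] (Pt B × B ⊆ A))
      in IsPartitionOf X M⋆
         × (∀ A → X A → Σ (List (Subset n)) λ I → Σ (List (Subset n)) λ J →
              All Pt I × All C J × IsUnionOf A I × IsUnionOf A J)
proposition2 n G F _ preserves M⋆ M⋆-strong M⋆-not-module P P-prime M⋆⊆P P-minimal =
  join-isPartition , λ A A∈𝒳 →
    let (I , I-blocks , A≡⋃I) = union-of-blocks (isPmax? H M⋆) A (join-refines inj₁ 𝒫-partition A∈𝒳)
        (J , J-blocks , A≡⋃J) = union-of-blocks (λ B → isPmax? G P B ×-dec B ⊆? M⋆) A
                                  (join-refines inj₂ 𝒬-partition A∈𝒳)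
    in I , J , I-blocks , J-blocks , A≡⋃I , A≡⋃J
  where
  H : Graph n
  H = G △ F
  𝒫-partition : IsPartitionOf (IsPmax H M⋆) M⋆
  𝒫-partition = Pmax-isPartition H (¬IsModule⇒AtLeastTwo G M⋆-not-module)
  𝒬-partition : IsPartitionOf (λ A → IsPmax G P A × A ⊆ M⋆) M⋆
  𝒬-partition = Children.children-isPartition {G = G} {H = H}
    preserves M⋆-strong M⋆-not-module P-prime M⋆⊆P P-minimal
  open Laminar 𝒫-partition 𝒬-partition
    (λ 𝒫A 𝒬B → strong-nested H (proj₁ 𝒫A) (preserves _ (proj₁ (proj₁ (proj₁ 𝒬B)))))
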